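{- Let $(\rho_b,\rho_g,\iota)$ be an effect-oriented rule, $m_b\colon L_b\hookrightarrow G$ a pre-match for its base rule, $\rho_i=(L_i\supseteq K_i\subseteq R_g,\mathit{ac}_i)$ an induced rule constructed from $L_i'$ and $K_i$, and let $e_1\colon L_i'\hookrightarrow G$ and $e_2\colon K_i\hookrightarrow G$ be injective morphisms with $e_1\circ\iota_L^{i\prime}=m_b$ and $e_2\circ\iota_K^g=m_b\circ l_b$. Let $m_i\colon L_i\to G$ be the unique morphism with $m_i\circ u=e_1$ and $m_i\circ l_i=e_2$. Then $m_i$ is injective and satisfies the dangling condition for $\rho_i$ if and only if (i) $e_1$ and $e_2$ only identify elements stemming from $K_b=K_g$, i.e. $e_1(x)=e_2(y)$ implies that $x$ and $y$ have a common pre-image in $K_b$ (under $k_1$ and $\iota_K^g$, respectively), and (ii) $e_1$ satisfies the dangling condition for $k_1$, i.e. $$\{v\in V_{L_i'}\mid \exists e\in E_G\setminus e_1(E_{L_i'}).\ \mathrm{src}_G(e)=e_1(v)\text{ or }\mathrm{tar}_G(e)=e_1(v)\}\subseteq k_1(V_{K_b}).$$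
   Context: All graphs are finite directed multigraphs (node set $V$, edge set $E$, source and target maps $\mathrm{src},\mathrm{tar}$) typed over a fixed type graph; all morphisms are type-preserving graph morphisms. A rule $\rho=(L\supseteq K\subseteq R,\mathit{ac})$ consists of graphs with $K$ a subgraph of $L$ and $R$ and a nested graph condition $\mathit{ac}$ over $L$; $\mathrm{Shift}(f,\mathit{ac})$ is the standard shift of $\mathit{ac}$ along an injective morphism $f$. A pre-match of $\rho$ in $G$ is an injective $m\colon L\hookrightarrow G$ satisfying $\mathit{ac}$. A morphism $m\colon L\to G$ satisfies the dangling condition for $\rho$ if every node $v$ of $L$ with $m(v)$ incident to an edge of $G$ outside $m(E_L)$ lies in $K$. A subrule $\rho'$ of $\rho$ is given by injective $\iota_L,\iota_K,\iota_R$ commuting with the rule inclusions, both squares pullbacks, $\mathit{ac}\equiv\mathrm{Shift}(\iota_L,\mathit{ac}')$. Effect-oriented rule $(\rho_b,\rho_g,\iota)$: a rule $\rho_g=(L_g\supseteq K_g\subseteq R_g,\mathit{ac}_g)$ with a subrule $\rho_b=(L_b\supseteq K_b\subseteq R_b,\mathit{ac}_b)$ (inclusion $l_b\colon K_b\subseteq L_b$) via inclusions $\iota=(\iota_L,\mathrm{id},\iota_R)$, with $K_b=K_g$. Induced rule: choose graphs $L_i'$ with $L_b\subseteq L_i'\subseteq L_g$ (inclusion $\iota_L^{i\prime}$) and $K_i$ with $K_g\subseteq K_i\subseteq R_g$ (inclusion $\iota_K^g$) and $K_i\cap R_b=K_b$; with $k_1=\iota_L^{i\prime}\circ l_b\colon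 K_b\hookrightarrow L_i'$, let $(L_i,u,l_i)$ be the pushout of $k_1$ and $\iota_K^g$, with $u\colon L_i'\subseteq L_i$ and $l_i\colon K_i\subseteq L_i$ inclusions; $\mathit{ac}_i=\mathrm{Shift}(u\circ\iota_L^{i\prime},\mathit{ac}_b)$ and $\rho_i=(L_i\supseteq K_i\subseteq R_g,\mathit{ac}_i)$. -}

module Defs where

open import Data.Nat using (ℕ)
open import Data.Fin using (Fin)
open import Data.Product using (Σ; Σ-syntax; _×_; _,_)
open import Data.Sum using (_⊎_)
open import Relation.Nullary using (¬_)
open import Relation.Binary.PropositionalEquality using (_≡_; refl; trans; sym; cong)
open import Function.Bundles using (_⇔_)
open import Level using (0ℓ) renaming (suc to lsuc)

record TypeGraph : Set where
  field
    nV nE : ℕ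
    src tar : Fin nE → Fin nV

record Graph (T : TypeGraph) : Set where
  field
    nV nE : ℕ
    src tar : Fin nE → Fin nV
    tyV : Fin nV → Fin (TypeGraph.nV T)
    tyE : Fin nE → Fin (TypeGraph.nE T)
    src-ty : ∀ e → tyV (src e) ≡ TypeGraph.src T (tyE e)
    tar-ty : ∀ e → tyV (tar e) ≡ TypeGraph.tar T (tyE e)

module _ {T : TypeGraph} where

  V : Graph T → Set
  V G = Fin (Graph.nV G)

  E : Graph T → Set
  E G = Fin (Graph.nE G)

  record Hom (G H : Graph T) : Set where
    field
      fV : V G → V H
      fE : E G → E H
      src-hom : ∀ e → fV (Graph.src G e) ≡ Graph.src H (fE e)
      tar-hom : ∀ e → fV (Graph.tar G e) ≡ Graph.tar H (fE e)
      tyV-hom : ∀ v → Graph.tyV H (fV v) ≡ Graph.tyV G v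
      tyE-hom : ∀ e → Graph.tyE H (fE e) ≡ Graph.tyE G e
  open Hom public

  idH : {G : Graph T} → Hom G G
  idH = record
    { fV = λ v → v ; fE = λ e → e
    ; src-hom = λ _ → refl ; tar-hom = λ _ → refl
    ; tyV-hom = λ _ → refl ; tyE-hom = λ _ → refl }

  infixr 9 _∘H_
  _∘H_ : {A B C : Graph T} → Hom B C → Hom A B → Hom A C
  _∘H_ {A} {B} {C} g f = record
    { fV = λ v → fV g (fV f v)
    ; fE = λ e → fE g (fE f e)
    ; src-hom = λ e → trans (cong (fV g) (src-hom f e)) (src-hom g (fE f e))
    ; tar-hom = λ e → trans (cong (fV g) (tar-hom f e)) (tar-hom g (fE f e))
    ; tyV-hom = λ v → trans (tyV-hom g (fV f v)) (tyV-hom f v)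
    ; tyE-hom = λ e → trans (tyE-hom g (fE f e)) (tyE-hom f e) }

  infix 4 _≈H_
  _≈H_ : {A B : Graph T} → Hom A B → Hom A B → Set
  f ≈H g = (∀ v → fV f v ≡ fV g v) × (∀ e → fE f e ≡ fE g e)

  IsInjective : {A B : Graph T} → Hom A B → Set
  IsInjective f = (∀ {x y} → fV f x ≡ fV f y → x ≡ y)
                × (∀ {x y} → fE f x ≡ fE f y → x ≡ y)

  IsPullback : {P B C D : Graph T} →
    Hom P B → Hom P C → Hom B D → Hom C D → Set
  IsPullback {P} {B} {C} f g h k =
    (h ∘H f ≈H k ∘H g) ×
    (∀ (X : Graph T) (p : Hom X B) (q : Hom X C) → h ∘H p ≈H k ∘H q →
       Σ[ m ∈ Hom X P ] ((f ∘H m ≈H p) × (g ∘H m ≈H q) ×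
         (∀ (m' : Hom X P) → f ∘H m' ≈H p → g ∘H m' ≈H q → m' ≈H m)))

  IsPushout : {A B C P : Graph T} →
    Hom A B → Hom A C → Hom B P → Hom C P → Set
  IsPushout {A} {B} {C} {P} f g p q =
    (p ∘H f ≈H q ∘H g) ×
    (∀ (X : Graph T) (x : Hom B X) (y : Hom C X) → x ∘H f ≈H y ∘H g →
       Σ[ m ∈ Hom P X ] ((m ∘H p ≈H x) × (m ∘H q ≈H y) ×
         (∀ (m' : Hom P X) → m' ∘H p ≈H x → m' ∘H q ≈H y → m' ≈H m)))

  Dangling : {K L G : Graph T} → Hom K L → Hom L G → Set
  Dangling {K} {L} {G} l m =
    ∀ (v : V L) →
      Σ[ e ∈ E G ] ((¬ (Σ[ e' ∈ E L ] fE m e' ≡ e)) ×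
                    (Graph.src G e ≡ fV m v ⊎ Graph.tar G e ≡ fV m v)) →
      Σ[ k ∈ V K ] fV l k ≡ v

  OnlyIdentifyFrom : {K A B G : Graph T} →
    Hom K A → Hom K B → Hom A G → Hom B G → Set
  OnlyIdentifyFrom {K} {A} {B} f g e1 e2 =
    (∀ (x : V A) (y : V B) → fV e1 x ≡ fV e2 y →
       Σ[ z ∈ V K ] (fV f z ≡ x × fV g z ≡ y)) ×
    (∀ (x : E A) (y : E B) → fE e1 x ≡ fE e2 y →
       Σ[ z ∈ E K ] (fE f z ≡ x × fE g z ≡ y))

-- Application conditions, treated abstractly:
-- a notion of condition over a graph, satisfaction by a morphism and
-- the shift along a morphism.

record CondSystem (T : TypeGraph) : Set₁ where
  field
    Cond  : Graph T → Set
    Sat   : {A G : Graph T} → Hom A G → Cond A → Set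
    Shift : {A B : Graph T} → Hom A B → Cond A → Cond B

module _ {T : TypeGraph} (CS : CondSystem T) where
  open CondSystem CS

  CondEquiv : {A : Graph T} → Cond A → Cond A → Set
  CondEquiv {A} c c' = ∀ (G : Graph T) (m : Hom A G) → IsInjective m →
    Sat m c ⇔ Sat m c'

  record Rule : Set where
    field
      L K R : Graph T
      l : Hom K L
      r : Hom K R
      l-inj : IsInjective l
      r-inj : IsInjective r
      ac : Cond L

  record IsSubrule (ρ' ρ : Rule) (ιL : Hom (Rule.L ρ') (Rule.L ρ))
      (ιK : Hom (Rule.K ρ') (Rule.K ρ)) (ιR : Hom (Rule.R ρ') (Rule.R ρ)) : Set where
    field
      ιL-inj : IsInjective ιL
      ιK-inj : IsInjective ιK
      ιR-inj : IsInjective ιR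
      commL : ιL ∘H Rule.l ρ' ≈H Rule.l ρ ∘H ιK
      commR : ιR ∘H Rule.r ρ' ≈H Rule.r ρ ∘H ιK
      pbL : IsPullback (Rule.l ρ') ιK ιL (Rule.l ρ)
      pbR : IsPullback (Rule.r ρ') ιK ιR (Rule.r ρ)
      acEq : CondEquiv (Rule.ac ρ) (Shift ιL (Rule.ac ρ'))

  record EffectOrientedRule : Set where
    field
      ρg : Rule
      Lb Rb : Graph T
      lb : Hom (Rule.K ρg) Lb
      rb : Hom (Rule.K ρg) Rb
      lb-inj : IsInjective lb
      rb-inj : IsInjective rb
      acb : Cond Lb
    ρb : Rule
    ρb = record { L = Lb ; K = Rule.K ρg ; R = Rb ; l = lb ; r = rb
                ; l-inj = lb-inj ; r-inj = rb-inj ; ac = acb }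
    field
      ιL : Hom Lb (Rule.L ρg)
      ιR : Hom Rb (Rule.R ρg)
      subrule : IsSubrule ρb ρg ιL idH ιR

  record InducedRule (Eo : EffectOrientedRule) : Set where
    open EffectOrientedRule Eo
    Kg = Rule.K ρg
    Lg = Rule.L ρg
    Rg = Rule.R ρg
    field
      Li' : Graph T
      ιLi' : Hom Lb Li'
      jLi' : Hom Li' Lg
      ιLi'-inj : IsInjective ιLi'
      jLi'-inj : IsInjective jLi'
      chainL : jLi' ∘H ιLi' ≈H ιL
      Ki : Graph T
      ιKg : Hom Kg Ki
      rKi : Hom Ki Rg
      ιKg-inj : IsInjective ιKg
      rKi-inj : IsInjective rKi
      chainK : rKi ∘H ιKg ≈H Rule.r ρg
      -- Ki ∩ Rb = Kb (inside Rg)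
      capV : ∀ (x : V Ki) (y : V Rb) → fV rKi x ≡ fV ιR y →
               Σ[ k ∈ V Kg ] (fV ιKg k ≡ x × fV rb k ≡ y)
      capE : ∀ (x : E Ki) (y : E Rb) → fE rKi x ≡ fE ιR y →
               Σ[ k ∈ E Kg ] (fE ιKg k ≡ x × fE rb k ≡ y)
    k1 : Hom Kg Li'
    k1 = ιLi' ∘H lb
    field
      Li : Graph T
      u : Hom Li' Li
      li : Hom Ki Li
      u-inj : IsInjective u
      li-inj : IsInjective li
      pushout : IsPushout k1 ιKg u li
    aci : Cond Li
    aci = Shift (u ∘H ιLi') acb
    ρi : Rule
    ρi = record { L = Li ; K = Ki ; R = Rg ; l = li ; r = rKi
                ; l-inj = li-inj ; r-inj = rKi-inj ; ac = aci }

-- Li is the pushout of Li' ← Kg → Ki with li injective, so u and li are jointly surjective and their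
-- images meet exactly in the image of Kg.  Hence mi is injective iff e1 and e2 are and they only glue
-- along Kg.  A node of Li coming from Ki never violates the dangling condition of ρi; a node of Li'
-- touching an edge outside e1(Li') either touches one outside mi(Li), or touches an edge of e2(Ki) and
-- then lies in Ki, hence in Kg.  The pushout is known only through its universal property, so the
-- covering and overlap facts are read off from morphisms into a 2-coloured copy of the type graph.
module Submission where

open import Defs
open import Data.Empty using (⊥-elim)
open import Data.Fin using (Fin; zero; suc; combine; remQuot; _≟_)
open import Data.Fin.Properties using (remQuot-combine; combine-injectiveʳ; any?)
open import Data.Nat using (_*_)
open import Data.Product using (Σ-syntax; _×_; _,_; proj₁; proj₂)
open import Data.Sum using (_⊎_; inj₁; inj₂) renaming (map to ⊎-map)
open import Function.Bundles using (_⇔_; mk⇔)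
open import Relation.Nullary using (Dec; yes; no)
open import Relation.Nullary.Decidable using (_⊎-dec_)
open import Relation.Unary using (Decidable)
open import Relation.Binary.PropositionalEquality
open import Relation.Binary.Bundles using (Setoid)
import Relation.Binary.Reasoning.Setoid as SetoidReasoning
open import Level using (0ℓ)

joint-injective : {B C P G : Set} (p : B → P) (q : C → P) (m : P → G) →
  (∀ x → (Σ[ b ∈ B ] p b ≡ x) ⊎ (Σ[ c ∈ C ] q c ≡ x)) →
  (∀ {b b'} → m (p b) ≡ m (p b') → b ≡ b') →
  (∀ {c c'} → m (q c) ≡ m (q c') → c ≡ c') →
  (∀ b c → m (p b) ≡ m (q c) → p b ≡ q c) →
  ∀ {x y} → m x ≡ m y → x ≡ y
joint-injective p q m cover p-inj q-inj glue {x} {y} eq with cover x | cover y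
... | inj₁ (b , refl) | inj₁ (b' , refl) = cong p (p-inj eq)
... | inj₁ (b , refl) | inj₂ (c , refl)  = glue b c eq
... | inj₂ (c , refl) | inj₁ (b , refl)  = sym (glue b c (sym eq))
... | inj₂ (c , refl) | inj₂ (c' , refl) = cong q (q-inj eq)

indicator : ∀ {a} {A : Set a} → Dec A → Fin 2
indicator (yes _) = suc zero
indicator (no _)  = zero

indicator-yes : ∀ {a} {A : Set a} (a? : Dec A) → A → indicator a? ≡ suc zero
indicator-yes (yes _) _ = refl
indicator-yes (no ¬a) a = ⊥-elim (¬a a)

indicator⇒ : ∀ {a} {A : Set a} (a? : Dec A) → indicator a? ≡ suc zero → A
indicator⇒ (yes a) _ = a
indicator⇒ (no _) ()

module _ {T : TypeGraph} where

  ≈H-refl : {A B : Graph T} {f : Hom A B} → f ≈H f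
  ≈H-refl = (λ _ → refl) , (λ _ → refl)

  Hom-setoid : Graph T → Graph T → Setoid 0ℓ 0ℓ
  Hom-setoid A B = record
    { Carrier = Hom A B
    ; _≈_ = _≈H_
    ; isEquivalence = record
        { refl = λ {f} → ≈H-refl {f = f}
        ; sym = λ (fV≡ , fE≡) → (λ v → sym (fV≡ v)) , (λ e → sym (fE≡ e))
        ; trans = λ (fV≡ , fE≡) (gV≡ , gE≡) →
            (λ v → trans (fV≡ v) (gV≡ v)) , (λ e → trans (fE≡ e) (gE≡ e))
        }
    }

  module ≈H-Reasoning {A B : Graph T} = SetoidReasoning (Hom-setoid A B)

  ∘H-congˡ : {A B C : Graph T} (h : Hom B C) {f g : Hom A B} → f ≈H g → h ∘H f ≈H h ∘H g
  ∘H-congˡ h (fV≡ , fE≡) = (λ v → cong (fV h) (fV≡ v)) , (λ e → cong (fE h) (fE≡ e))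

  ImageV : {A B : Graph T} → Hom A B → V B → Set
  ImageV {A} f b = Σ[ a ∈ V A ] fV f a ≡ b

  ImageE : {A B : Graph T} → Hom A B → E B → Set
  ImageE {A} f b = Σ[ a ∈ E A ] fE f a ≡ b

  imageV? : {A B : Graph T} (f : Hom A B) → Decidable (ImageV f)
  imageV? f b = any? (λ a → fV f a ≟ b)

  imageE? : {A B : Graph T} (f : Hom A B) → Decidable (ImageE f)
  imageE? f b = any? (λ a → fE f a ≟ b)

  endpoint-in-image : {A G : Graph T} (h : Hom A G) (e : E A) {x : V G} →
    Graph.src G (fE h e) ≡ x ⊎ Graph.tar G (fE h e) ≡ x → ImageV h x
  endpoint-in-image {A} h e (inj₁ src≡x) = Graph.src A e , trans (src-hom h e) src≡x
  endpoint-in-image {A} h e (inj₂ tar≡x) = Graph.tar A e , trans (tar-hom h e) tar≡x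

-- A node is a type paired with a colour; an edge combine (combine (combine t s) r) d is an edge of
-- type t with source colour s, target colour r and colour d.  Every colouring of a graph's nodes and
-- edges is thus a morphism into this graph.
module Colouring {T : TypeGraph} where
  open TypeGraph T using () renaming (nV to nVT; nE to nET; src to srcT; tar to tarT)

  base : ∀ {n} → Fin (n * 2) → Fin n
  base {n} x = proj₁ (remQuot {n} 2 x)

  mark : ∀ {n} → Fin (n * 2) → Fin 2
  mark {n} x = proj₂ (remQuot {n} 2 x)

  base-combine : ∀ {n} (t : Fin n) (i : Fin 2) → base (combine t i) ≡ t
  base-combine t i = cong proj₁ (remQuot-combine t i)

  mark-combine : ∀ {n} (t : Fin n) (i : Fin 2) → mark {n} (combine t i) ≡ i
  mark-combine t i = cong proj₂ (remQuot-combine t i)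

  edge : Fin nET → Fin 2 → Fin 2 → Fin 2 → Fin (nET * 2 * 2 * 2)
  edge t s r d = combine (combine (combine t s) r) d

  edge-cong : ∀ {t t' s s' r r' d d'} → t ≡ t' → s ≡ s' → r ≡ r' → d ≡ d' →
    edge t s r d ≡ edge t' s' r' d'
  edge-cong refl refl refl refl = refl

  edgeType : Fin (nET * 2 * 2 * 2) → Fin nET
  edgeType e = base (base (base e))

  sourceColour : Fin (nET * 2 * 2 * 2) → Fin 2
  sourceColour e = mark {nET} (base (base e))

  targetColour : Fin (nET * 2 * 2 * 2) → Fin 2
  targetColour e = mark {nET * 2} (base e)

  base-base-edge : ∀ t s r d → base (base (edge t s r d)) ≡ combine t s
  base-base-edge t s r d =
    trans (cong base (base-combine (combine (combine t s) r) d)) (base-combine (combine t s) r)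

  edgeType-edge : ∀ t s r d → edgeType (edge t s r d) ≡ t
  edgeType-edge t s r d = trans (cong base (base-base-edge t s r d)) (base-combine t s)

  sourceColour-edge : ∀ t s r d → sourceColour (edge t s r d) ≡ s
  sourceColour-edge t s r d = trans (cong (mark {nET}) (base-base-edge t s r d)) (mark-combine t s)

  targetColour-edge : ∀ t s r d → targetColour (edge t s r d) ≡ r
  targetColour-edge t s r d =
    trans (cong (mark {nET * 2}) (base-combine (combine (combine t s) r) d)) (mark-combine (combine t s) r)

  Coloured : Graph T
  Coloured = record
    { nV = nVT * 2
    ; nE = nET * 2 * 2 * 2
    ; src = λ e → combine (srcT (edgeType e)) (sourceColour e)
    ; tar = λ e → combine (tarT (edgeType e)) (targetColour e)
    ; tyV = base
    ; tyE = edgeType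
    ; src-ty = λ e → base-combine (srcT (edgeType e)) (sourceColour e)
    ; tar-ty = λ e → base-combine (tarT (edgeType e)) (targetColour e)
    }

  colour : (A : Graph T) → (V A → Fin 2) → (E A → Fin 2) → Hom A Coloured
  colour A c d = record
    { fV = λ v → combine (tyV v) (c v)
    ; fE = λ e → edge (tyE e) (c (src e)) (c (tar e)) (d e)
    ; src-hom = λ e → cong₂ combine
        (trans (src-ty e) (cong srcT (sym (edgeType-edge (tyE e) (c (src e)) (c (tar e)) (d e)))))
        (sym (sourceColour-edge (tyE e) (c (src e)) (c (tar e)) (d e)))
    ; tar-hom = λ e → cong₂ combine
        (trans (tar-ty e) (cong tarT (sym (edgeType-edge (tyE e) (c (src e)) (c (tar e)) (d e)))))
        (sym (targetColour-edge (tyE e) (c (src e)) (c (tar e)) (d e)))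
    ; tyV-hom = λ v → base-combine (tyV v) (c v)
    ; tyE-hom = λ e → edgeType-edge (tyE e) (c (src e)) (c (tar e)) (d e)
    }
    where open Graph A

  colour-natural : {A B : Graph T} (f : Hom A B)
    (c : V B → Fin 2) (d : E B → Fin 2) (c' : V A → Fin 2) (d' : E A → Fin 2) →
    (∀ v → c (fV f v) ≡ c' v) → (∀ e → d (fE f e) ≡ d' e) →
    colour B c d ∘H f ≈H colour A c' d'
  colour-natural {A} f c _ _ _ cc dd =
    (λ v → cong₂ combine (tyV-hom f v) (cc v)) ,
    (λ e → edge-cong (tyE-hom f e)
      (trans (cong c (sym (src-hom f e))) (cc (Graph.src A e)))
      (trans (cong c (sym (tar-hom f e))) (cc (Graph.tar A e)))
      (dd e))

  colourV-reflects : {A B : Graph T} (c : V A → Fin 2) (d : E A → Fin 2)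
    (c' : V B → Fin 2) (d' : E B → Fin 2) {a : V A} {b : V B} →
    fV (colour A c d) a ≡ fV (colour B c' d') b → c a ≡ c' b
  colourV-reflects {A} {B} c _ c' _ {a} {b} = combine-injectiveʳ (Graph.tyV A a) (c a) (Graph.tyV B b) (c' b)

  colourE-reflects : {A B : Graph T} (c : V A → Fin 2) (d : E A → Fin 2)
    (c' : V B → Fin 2) (d' : E B → Fin 2) {a : E A} {b : E B} →
    fE (colour A c d) a ≡ fE (colour B c' d') b → d a ≡ d' b
  colourE-reflects {A} {B} c d c' d' {a} {b} =
    combine-injectiveʳ (stem A c a) (d a) (stem B c' b) (d' b)
    where
    stem : (X : Graph T) → (V X → Fin 2) → E X → Fin (nET * 2 * 2)
    stem X c x = combine (combine (Graph.tyE X x) (c (Graph.src X x))) (c (Graph.tar X x))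

module Pushout {T : TypeGraph} {A B C P : Graph T}
         {f : Hom A B} {g : Hom A C} {p : Hom B P} {q : Hom C P}
         (po : IsPushout f g p q) where
  open Colouring {T}

  private
    commutes : p ∘H f ≈H q ∘H g
    commutes = proj₁ po

    one : ∀ {X : Set} → X → Fin 2
    one _ = suc zero

    allOne : (X : Graph T) → Hom X Coloured
    allOne X = colour X one one

  jointly-epic : {X : Graph T} (h h' : Hom P X) →
    h ∘H p ≈H h' ∘H p → h ∘H q ≈H h' ∘H q → h ≈H h'
  jointly-epic h h' hp≈ hq≈ = begin
    h         ≈⟨ unique h hp≈ hq≈ ⟩
    mediator  ≈⟨ unique h' (≈H-refl {f = h' ∘H p}) (≈H-refl {f = h' ∘H q}) ⟨
    h'        ∎
    where
    open ≈H-Reasoning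
    compatible : (h' ∘H p) ∘H f ≈H (h' ∘H q) ∘H g
    compatible = ∘H-congˡ h' {p ∘H f} {q ∘H g} commutes
    mediation = proj₂ po _ (h' ∘H p) (h' ∘H q) compatible
    mediator = proj₁ mediation
    unique : ∀ k → k ∘H p ≈H h' ∘H p → k ∘H q ≈H h' ∘H q → k ≈H mediator
    unique = proj₂ (proj₂ (proj₂ mediation))

  jointly-surjective :
    (∀ v → ImageV p v ⊎ ImageV q v) × (∀ e → ImageE p e ⊎ ImageE q e)
  jointly-surjective =
    (λ v → indicator⇒ (coveredV? v) (colourV-reflects {P} {P} cV cE one one (proj₁ covered≈allOne v))) ,
    (λ e → indicator⇒ (coveredE? e) (colourE-reflects {P} {P} cV cE one one (proj₂ covered≈allOne e)))
    where
    coveredV? = λ v → imageV? p v ⊎-dec imageV? q v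
    coveredE? = λ e → imageE? p e ⊎-dec imageE? q e
    cV = λ v → indicator (coveredV? v)
    cE = λ e → indicator (coveredE? e)
    covered≈allOne : colour P cV cE ≈H allOne P
    covered≈allOne = jointly-epic (colour P cV cE) (allOne P)
      (begin
        colour P cV cE ∘H p  ≈⟨ colour-natural p cV cE one one
                                  (λ b → indicator-yes (coveredV? _) (inj₁ (b , refl)))
                                  (λ b → indicator-yes (coveredE? _) (inj₁ (b , refl))) ⟩
        allOne B             ≈⟨ colour-natural p one one one one (λ _ → refl) (λ _ → refl) ⟨
        allOne P ∘H p        ∎)
      (begin
        colour P cV cE ∘H q  ≈⟨ colour-natural q cV cE one one
                                  (λ c → indicator-yes (coveredV? _) (inj₂ (c , refl)))
                                  (λ c → indicator-yes (coveredE? _) (inj₂ (c , refl))) ⟩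
        allOne C             ≈⟨ colour-natural q one one one one (λ _ → refl) (λ _ → refl) ⟨
        allOne P ∘H q        ∎)
      where open ≈H-Reasoning

  overlap-in-image :
    (∀ b → ImageV q (fV p b) → ImageV f b) × (∀ b → ImageE q (fE p b) → ImageE f b)
  overlap-in-image =
    (λ b (c , qc≡pb) → indicator⇒ (imageV? f b)
      (colourV-reflects {B} {C} inV inE one one (trans (sym (proj₁ m∘p≈inImage b))
                                                 (trans (cong (fV m) (sym qc≡pb)) (proj₁ m∘q≈allOne c))))) ,
    (λ b (c , qc≡pb) → indicator⇒ (imageE? f b)
      (colourE-reflects {B} {C} inV inE one one (trans (sym (proj₂ m∘p≈inImage b))
                                                 (trans (cong (fE m) (sym qc≡pb)) (proj₂ m∘q≈allOne c)))))
    where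
    open ≈H-Reasoning
    inV = λ b → indicator (imageV? f b)
    inE = λ b → indicator (imageE? f b)
    -- Colouring B by membership in the image of f and C all 1 is a cocone; its mediator m sees
    -- the colour of b at p b and the colour 1 at q c.
    compatible : colour B inV inE ∘H f ≈H allOne C ∘H g
    compatible = begin
      colour B inV inE ∘H f  ≈⟨ colour-natural f inV inE one one
                                  (λ a → indicator-yes (imageV? f _) (a , refl))
                                  (λ a → indicator-yes (imageE? f _) (a , refl)) ⟩
      allOne A               ≈⟨ colour-natural g one one one one (λ _ → refl) (λ _ → refl) ⟨
      allOne C ∘H g          ∎
    mediation = proj₂ po Coloured (colour B inV inE) (allOne C) compatible
    m = proj₁ mediation
    m∘p≈inImage = proj₁ (proj₂ mediation)
    m∘q≈allOne = proj₁ (proj₂ (proj₂ mediation))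

  legs-onlyIdentifyFrom : IsInjective q → OnlyIdentifyFrom f g p q
  legs-onlyIdentifyFrom (qV-inj , qE-inj) =
    (λ b c pb≡qc → let (a , fa≡b) = proj₁ overlap-in-image b (c , sym pb≡qc) in
      a , fa≡b , qV-inj (trans (sym (proj₁ commutes a)) (trans (cong (fV p) fa≡b) pb≡qc))) ,
    (λ b c pb≡qc → let (a , fa≡b) = proj₂ overlap-in-image b (c , sym pb≡qc) in
      a , fa≡b , qE-inj (trans (sym (proj₂ commutes a)) (trans (cong (fE p) fa≡b) pb≡qc)))

  injective⇒onlyIdentifyFrom : IsInjective q →
    {G : Graph T} (m : Hom P G) (e1 : Hom B G) (e2 : Hom C G) →
    m ∘H p ≈H e1 → m ∘H q ≈H e2 → IsInjective m → OnlyIdentifyFrom f g e1 e2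
  injective⇒onlyIdentifyFrom q-inj m _ _ (pV , pE) (qV , qE) (mV-inj , mE-inj) =
    (λ b c e1b≡e2c → overlapV b c (mV-inj (trans (pV b) (trans e1b≡e2c (sym (qV c)))))) ,
    (λ b c e1b≡e2c → overlapE b c (mE-inj (trans (pE b) (trans e1b≡e2c (sym (qE c))))))
    where
    overlapV = proj₁ (legs-onlyIdentifyFrom q-inj)
    overlapE = proj₂ (legs-onlyIdentifyFrom q-inj)

  onlyIdentifyFrom⇒injective :
    {G : Graph T} (m : Hom P G) (e1 : Hom B G) (e2 : Hom C G) →
    m ∘H p ≈H e1 → m ∘H q ≈H e2 → IsInjective e1 → IsInjective e2 →
    OnlyIdentifyFrom f g e1 e2 → IsInjective m
  onlyIdentifyFrom⇒injective m _ _ (pV , pE) (qV , qE) (e1V-inj , e1E-inj) (e2V-inj , e2E-inj)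
                             (identifyV , identifyE) =
    joint-injective (fV p) (fV q) (fV m) (proj₁ jointly-surjective)
      (λ eq → e1V-inj (trans (sym (pV _)) (trans eq (pV _))))
      (λ eq → e2V-inj (trans (sym (qV _)) (trans eq (qV _))))
      glueV ,
    joint-injective (fE p) (fE q) (fE m) (proj₂ jointly-surjective)
      (λ eq → e1E-inj (trans (sym (pE _)) (trans eq (pE _))))
      (λ eq → e2E-inj (trans (sym (qE _)) (trans eq (qE _))))
      glueE
    where
    glueV : ∀ b c → fV m (fV p b) ≡ fV m (fV q c) → fV p b ≡ fV q c
    glueV b c eq with identifyV b c (trans (sym (pV b)) (trans eq (qV c)))
    ... | a , refl , refl = proj₁ commutes a
    glueE : ∀ b c → fE m (fE p b) ≡ fE m (fE q c) → fE p b ≡ fE q c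
    glueE b c eq with identifyE b c (trans (sym (pE b)) (trans eq (qE c)))
    ... | a , refl , refl = proj₂ commutes a

  dangling-restrict : {G : Graph T} (m : Hom P G) (e1 : Hom B G) →
    m ∘H p ≈H e1 → IsInjective m → Dangling q m → Dangling f e1
  dangling-restrict m _ (pV , pE) (mV-inj , _) q-dangling b (e , e∉e1 , incident)
    with any? (λ e' → fE m e' ≟ e)
  ... | no e∉m = proj₁ overlap-in-image b
                   (q-dangling (fV p b) (e , e∉m , ⊎-map (λ eq → trans eq (sym (pV b)))
                                                         (λ eq → trans eq (sym (pV b))) incident))
  ... | yes (e' , refl) with proj₂ jointly-surjective e'
  ...   | inj₁ (b' , refl) = ⊥-elim (e∉e1 (b' , sym (pE b')))
  ...   | inj₂ (c , refl) =
    let (w , mqw≡e1b) = endpoint-in-image (m ∘H q) c incident in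
    proj₁ overlap-in-image b (w , mV-inj (trans mqw≡e1b (sym (pV b))))

  dangling-extend : {G : Graph T} (m : Hom P G) (e1 : Hom B G) →
    m ∘H p ≈H e1 → Dangling f e1 → Dangling q m
  dangling-extend m _ (pV , pE) f-dangling x (e , e∉m , incident)
    with proj₁ jointly-surjective x
  ... | inj₂ (c , refl) = c , refl
  ... | inj₁ (b , refl)
    with f-dangling b (e , (λ (e' , e1e'≡e) → e∉m (fE p e' , trans (pE e') e1e'≡e))
                         , ⊎-map (λ eq → trans eq (pV b)) (λ eq → trans eq (pV b)) incident)
  ...   | a , refl = fV g a , sym (proj₁ commutes a)

lemma2 : {T : TypeGraph} (CS : CondSystem T)
    (Eo : EffectOrientedRule CS) (I : InducedRule CS Eo)
    (G : Graph T)
    (mb : Hom (EffectOrientedRule.Lb Eo) G) →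
    IsInjective mb → CondSystem.Sat CS mb (EffectOrientedRule.acb Eo) →
    (e1 : Hom (InducedRule.Li' I) G) (e2 : Hom (InducedRule.Ki I) G) →
    IsInjective e1 → IsInjective e2 →
    e1 ∘H InducedRule.ιLi' I ≈H mb →
    e2 ∘H InducedRule.ιKg I ≈H mb ∘H EffectOrientedRule.lb Eo →
    (mi : Hom (InducedRule.Li I) G) →
    mi ∘H InducedRule.u I ≈H e1 →
    mi ∘H InducedRule.li I ≈H e2 →
    (IsInjective mi × Dangling (Rule.l (InducedRule.ρi I)) mi)
      ⇔ (OnlyIdentifyFrom (InducedRule.k1 I) (InducedRule.ιKg I) e1 e2
         × Dangling (InducedRule.k1 I) e1)
lemma2 CS Eo I G _ _ _ e1 e2 e1-inj e2-inj _ _ mi mi∘u≈e1 mi∘li≈e2 = mk⇔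
  (λ (mi-inj , li-dangling) →
    injective⇒onlyIdentifyFrom li-inj mi e1 e2 mi∘u≈e1 mi∘li≈e2 mi-inj ,
    dangling-restrict mi e1 mi∘u≈e1 mi-inj li-dangling)
  (λ (identifies , k1-dangling) →
    onlyIdentifyFrom⇒injective mi e1 e2 mi∘u≈e1 mi∘li≈e2 e1-inj e2-inj identifies ,
    dangling-extend mi e1 mi∘u≈e1 k1-dangling)
  where
  open InducedRule I
  open Pushout {f = k1} {g = ιKg} {p = u} {q = li} pushout
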